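{- Let $\Gamma_1$ and $\Gamma_2$ be tournaments. Then, for each positive integer $k$, \[ \mathbf{1}^\top A(\Gamma_1\oplus \Gamma_2)^{k}\mathbf{1} = \mathbf{1}^\top A(\Gamma_1)^{k}\mathbf{1}+\mathbf{1}^\top A(\Gamma_2)^{k}\mathbf{1}+\sum_{i=1}^{k}\mathbf{1}^\top A(\Gamma_1)^{i-1}\mathbf{1}\cdot \mathbf{1}^\top A(\Gamma_2)^{k-i}\mathbf{1}. \]
   Context: A tournament is a loopless digraph in which, for each pair of distinct vertices $i,j$, exactly one of the arcs $(i,j),(j,i)$ is present; its adjacency matrix $A(\Gamma)$ has $(i,j)$-entry $1$ iff $(i,j)$ is an arc. For tournaments $\Gamma_1,\Gamma_2$, $\Gamma_1\oplus\Gamma_2$ is the tournament on the disjoint union of their vertex sets consisting of the arcs of $\Gamma_1$, the arcs of $\Gamma_2$, and an arc from every vertex of $\Gamma_2$ to every vertex of $\Gamma_1$, i.e. $A(\Gamma_1\oplus\Gamma_2)=\begin{pmatrix}A(\Gamma_1)&O\\ J&A(\Gamma_2)\end{pmatrix}$ with $J$ all-ones. $\mathbf 1$ is the all-ones vector. -}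

module Defs where

open import Data.Nat using (ℕ; zero; suc; _+_; _*_; _∸_)
open import Data.Bool using (Bool; true; false; not; if_then_else_)
open import Relation.Nullary.Decidable using (⌊_⌋)
open import Data.Fin using (Fin; splitAt; toℕ; _≟_)
open import Data.Sum using (inj₁; inj₂)
open import Relation.Binary.PropositionalEquality using (_≡_; _≢_)

∑ : (n : ℕ) → (Fin n → ℕ) → ℕ
∑ zero f = 0
∑ (suc n) f = f Fin.zero + ∑ n (λ i → f (Fin.suc i))

Mat : ℕ → Set
Mat n = Fin n → Fin n → ℕ

_⊗_ : {n : ℕ} → Mat n → Mat n → Mat n
_⊗_ {n} A B i j = ∑ n (λ l → A i l * B l j)

I : (n : ℕ) → Mat n
I n i j = if ⌊ i ≟ j ⌋ then 1 else 0

_^^_ : {n : ℕ} → Mat n → ℕ → Mat n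
_^^_ {n} A zero = I n
A ^^ suc k = A ⊗ (A ^^ k)

total : {n : ℕ} → Mat n → ℕ
total {n} A = ∑ n (λ i → ∑ n (λ j → A i j))

record Tournament (n : ℕ) : Set where
  field
    arc      : Fin n → Fin n → Bool
    loopless : ∀ i → arc i i ≡ false
    oneArc   : ∀ i j → i ≢ j → arc j i ≡ not (arc i j)

open Tournament public

bool→ℕ : Bool → ℕ
bool→ℕ true = 1
bool→ℕ false = 0

adj : {n : ℕ} → Tournament n → Mat n
adj T i j = bool→ℕ (arc T i j)

-- adjacency matrix of Γ₁ ⊕ Γ₂ on Fin (m + n) (vertices of Γ₁ first):
-- A(Γ₁ ⊕ Γ₂) = [[A(Γ₁), O], [J, A(Γ₂)]].
adj⊕ : {m n : ℕ} → Tournament m → Tournament n → Mat (m + n)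
adj⊕ {m} T₁ T₂ i j with splitAt m i | splitAt m j
... | inj₁ a | inj₁ b = adj T₁ a b
... | inj₁ a | inj₂ b = 0
... | inj₂ a | inj₁ b = 1
... | inj₂ a | inj₂ b = adj T₂ a b

{-# OPTIONS --safe #-}
module Submission where

-- The first m rows of A(Γ₁ ⊕ Γ₂)ᵏ𝟏 are those of A(Γ₁)ᵏ𝟏, as the top-right block is O.
-- Through the block J, each step adds σ_k = 𝟏ᵀA(Γ₁)ᵏ𝟏 to every one of the last n rows,
-- so they satisfy b₀ = 𝟏, b_{k+1} = A(Γ₂) b_k + σ_k 𝟏, whose solution is
-- b_k = A(Γ₂)ᵏ𝟏 + Σ_{i<k} σ_i A(Γ₂)^{k-1-i}𝟏. Summing all rows gives the identity,
-- which therefore holds for any matrices in this block shape, not only tournaments.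

open import Defs
open import Data.Nat using (ℕ; zero; suc; _+_; _*_; _∸_; _≤_)
open import Data.Nat.Properties
  using (+-*-semiring; *-commutativeSemigroup; +-assoc; +-comm; +-identityʳ;
         *-identityˡ; *-identityʳ; *-distribˡ-+; +-∸-assoc; n∸n≡0)
open import Data.Fin using (Fin; toℕ; _↑ˡ_; _↑ʳ_; inject₁; fromℕ; _≟_)
open import Data.Fin.Properties using (splitAt-↑ˡ; splitAt-↑ʳ; toℕ-inject₁; toℕ-fromℕ; toℕ<n)
open import Algebra.Properties.Semiring.Sum +-*-semiring
  using (sum; sum-syntax; sum-cong-≗; sum-replicate-zero; sum-init-last; ∑-distrib-+; ∑-comm;
         *-distribˡ-sum)
open import Algebra.Properties.CommutativeSemigroup *-commutativeSemigroup using (x∙yz≈y∙xz)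
open import Function using (_∘_)
open import Relation.Nullary using (yes; no)
open import Relation.Binary.PropositionalEquality using (_≡_; refl; sym; trans; cong; cong₂)
open import Relation.Binary.PropositionalEquality.Properties using (module ≡-Reasoning)
open ≡-Reasoning

∑≡sum : ∀ n (f : Fin n → ℕ) → ∑ n f ≡ sum f
∑≡sum zero    f = refl
∑≡sum (suc n) f = cong (f Fin.zero +_) (∑≡sum n (f ∘ Fin.suc))

sum-↑ : ∀ m {n} (f : Fin (m + n) → ℕ) →
        sum f ≡ ∑[ i < m ] f (i ↑ˡ n) + ∑[ j < n ] f (m ↑ʳ j)
sum-↑ zero    f = refl
sum-↑ (suc m) {n} f =
  trans (cong (f Fin.zero +_) (sum-↑ m {n} (f ∘ Fin.suc))) (sym (+-assoc (f Fin.zero) _ _))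

I-suc : ∀ n (i j : Fin n) → I (suc n) (Fin.suc i) (Fin.suc j) ≡ I n i j
I-suc n i j with i ≟ j
... | yes _ = refl
... | no  _ = refl

sum-I : ∀ n (i : Fin n) → sum (I n i) ≡ 1
sum-I (suc n) Fin.zero    = cong suc (sum-replicate-zero n)
sum-I (suc n) (Fin.suc i) = trans (sum-cong-≗ (I-suc n i)) (sum-I n i)

walks : ∀ {n} → Mat n → ℕ → Fin n → ℕ
walks     A zero    _ = 1
walks {n} A (suc k) i = ∑[ l < n ] (A i l * walks A k l)

sum-^^ : ∀ {n} (A : Mat n) k i → sum ((A ^^ k) i) ≡ walks A k i
sum-^^ {n} A zero    i = sum-I n i
sum-^^ {n} A (suc k) i = begin
  sum ((A ^^ suc k) i)
    ≡⟨ sum-cong-≗ (λ j → ∑≡sum n (λ l → A i l * (A ^^ k) l j)) ⟩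
  ∑[ j < n ] ∑[ l < n ] (A i l * (A ^^ k) l j)
    ≡⟨ ∑-comm (λ j l → A i l * (A ^^ k) l j) ⟩
  ∑[ l < n ] ∑[ j < n ] (A i l * (A ^^ k) l j)
    ≡⟨ sum-cong-≗ (λ l → sym (*-distribˡ-sum (A i l) ((A ^^ k) l))) ⟩
  ∑[ l < n ] (A i l * sum ((A ^^ k) l))
    ≡⟨ sum-cong-≗ (λ l → cong (A i l *_) (sum-^^ A k l)) ⟩
  walks A (suc k) i
    ∎

total-^^ : ∀ {n} (A : Mat n) k → total (A ^^ k) ≡ sum (walks A k)
total-^^ {n} A k =
  trans (∑≡sum n _) (sum-cong-≗ (λ i → trans (∑≡sum n _) (sum-^^ A k i)))

convolution : ∀ {n} → (ℕ → ℕ) → Mat n → ℕ → Fin n → ℕ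
convolution s B k j = ∑[ i < k ] (s (toℕ i) * walks B (k ∸ suc (toℕ i)) j)

convolution-suc : ∀ {n} s (B : Mat n) k j →
  convolution s B (suc k) j ≡ ∑[ l < n ] (B j l * convolution s B k l) + s k
convolution-suc {n} s B k j = begin
  convolution s B (suc k) j
    ≡⟨ sum-init-last (λ i → s (toℕ i) * walks B (suc k ∸ suc (toℕ i)) j) ⟩
  ∑[ i < k ] (s (toℕ (inject₁ i)) * walks B (k ∸ toℕ (inject₁ i)) j)
    + s (toℕ (fromℕ k)) * walks B (k ∸ toℕ (fromℕ k)) j
    ≡⟨ cong₂ _+_ (sum-cong-≗ init-term) last-term ⟩
  ∑[ i < k ] ∑[ l < n ] (B j l * (s (toℕ i) * w i l)) + s k
    ≡⟨ cong (_+ s k) (∑-comm {k} {n} (λ i l → B j l * (s (toℕ i) * w i l))) ⟩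
  ∑[ l < n ] ∑[ i < k ] (B j l * (s (toℕ i) * w i l)) + s k
    ≡⟨ cong (_+ s k) (sum-cong-≗ (λ l → sym (*-distribˡ-sum (B j l) (λ i → s (toℕ i) * w i l)))) ⟩
  ∑[ l < n ] (B j l * convolution s B k l) + s k
    ∎
  where
  w : Fin k → Fin n → ℕ
  w i = walks B (k ∸ suc (toℕ i))

  last-term : s (toℕ (fromℕ k)) * walks B (k ∸ toℕ (fromℕ k)) j ≡ s k
  last-term rewrite toℕ-fromℕ k | n∸n≡0 k = *-identityʳ (s k)

  init-term : ∀ i → s (toℕ (inject₁ i)) * walks B (k ∸ toℕ (inject₁ i)) j
                ≡ ∑[ l < n ] (B j l * (s (toℕ i) * w i l))
  init-term i = begin
    s (toℕ (inject₁ i)) * walks B (k ∸ toℕ (inject₁ i)) j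
      ≡⟨ cong (λ t → s t * walks B (k ∸ t) j) (toℕ-inject₁ i) ⟩
    s (toℕ i) * walks B (k ∸ toℕ i) j
      -- (1 + k) ∸ (1 + toℕ i) computes to k ∸ toℕ i
      ≡⟨ cong (λ t → s (toℕ i) * walks B t j) (+-∸-assoc 1 (toℕ<n i)) ⟩
    s (toℕ i) * walks B (suc (k ∸ suc (toℕ i))) j
      ≡⟨ *-distribˡ-sum (s (toℕ i)) (λ l → B j l * w i l) ⟩
    ∑[ l < n ] (s (toℕ i) * (B j l * w i l))
      ≡⟨ sum-cong-≗ (λ l → x∙yz≈y∙xz (s (toℕ i)) (B j l) (w i l)) ⟩
    ∑[ l < n ] (B j l * (s (toℕ i) * w i l))
      ∎

sum-convolution : ∀ {n} s (B : Mat n) k →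
  sum (convolution s B k) ≡ ∑[ i < k ] (s (toℕ i) * sum (walks B (k ∸ suc (toℕ i))))
sum-convolution {n} s B k =
  trans (∑-comm {n} {k} (λ j i → s (toℕ i) * walks B (k ∸ suc (toℕ i)) j))
        (sum-cong-≗ {k} (λ i → sym (*-distribˡ-sum (s (toℕ i)) (walks B (k ∸ suc (toℕ i))))))

record Is⊕ {m n} (A : Mat m) (B : Mat n) (M : Mat (m + n)) : Set where
  field
    top-left     : ∀ i j → M (i ↑ˡ n) (j ↑ˡ n) ≡ A i j
    top-right    : ∀ i j → M (i ↑ˡ n) (m ↑ʳ j) ≡ 0
    bottom-left  : ∀ i j → M (m ↑ʳ i) (j ↑ˡ n) ≡ 1
    bottom-right : ∀ i j → M (m ↑ʳ i) (m ↑ʳ j) ≡ B i j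

adj⊕-is⊕ : ∀ {m n} (Γ₁ : Tournament m) (Γ₂ : Tournament n) →
           Is⊕ (adj Γ₁) (adj Γ₂) (adj⊕ Γ₁ Γ₂)
adj⊕-is⊕ {m} {n} Γ₁ Γ₂ = record
  { top-left = top-left ; top-right = top-right
  ; bottom-left = bottom-left ; bottom-right = bottom-right
  }
  where
  M : Mat (m + n)
  M = adj⊕ Γ₁ Γ₂

  top-left : ∀ i j → M (i ↑ˡ n) (j ↑ˡ n) ≡ adj Γ₁ i j
  top-left i j rewrite splitAt-↑ˡ m i n | splitAt-↑ˡ m j n = refl

  top-right : ∀ i j → M (i ↑ˡ n) (m ↑ʳ j) ≡ 0
  top-right i j rewrite splitAt-↑ˡ m i n | splitAt-↑ʳ m n j = refl

  bottom-left : ∀ i j → M (m ↑ʳ i) (j ↑ˡ n) ≡ 1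
  bottom-left i j rewrite splitAt-↑ʳ m n i | splitAt-↑ˡ m j n = refl

  bottom-right : ∀ i j → M (m ↑ʳ i) (m ↑ʳ j) ≡ adj Γ₂ i j
  bottom-right i j rewrite splitAt-↑ʳ m n i | splitAt-↑ʳ m n j = refl

module _ {m n} {A : Mat m} {B : Mat n} {M : Mat (m + n)} (M-is⊕ : Is⊕ A B M) where
  open Is⊕ M-is⊕

  σ : ℕ → ℕ
  σ = sum ∘ walks A

  walks-↑ˡ : ∀ k i → walks M k (i ↑ˡ n) ≡ walks A k i
  walks-↑ˡ zero    i = refl
  walks-↑ˡ (suc k) i = begin
    walks M (suc k) (i ↑ˡ n)
      ≡⟨ sum-↑ m (λ l → M (i ↑ˡ n) l * walks M k l) ⟩
    ∑[ l < m ] (M (i ↑ˡ n) (l ↑ˡ n) * walks M k (l ↑ˡ n))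
      + ∑[ l < n ] (M (i ↑ˡ n) (m ↑ʳ l) * walks M k (m ↑ʳ l))
      ≡⟨ cong₂ _+_ (sum-cong-≗ (λ l → cong₂ _*_ (top-left i l) (walks-↑ˡ k l)))
                   (trans (sum-cong-≗ (λ l → cong (_* walks M k (m ↑ʳ l)) (top-right i l)))
                          (sum-replicate-zero n)) ⟩
    walks A (suc k) i + 0
      ≡⟨ +-identityʳ _ ⟩
    walks A (suc k) i
      ∎

  walks-↑ʳ : ∀ k j → walks M k (m ↑ʳ j) ≡ walks B k j + convolution σ B k j
  walks-↑ʳ zero    j = refl
  walks-↑ʳ (suc k) j = begin
    walks M (suc k) (m ↑ʳ j)
      ≡⟨ sum-↑ m (λ l → M (m ↑ʳ j) l * walks M k l) ⟩
    ∑[ l < m ] (M (m ↑ʳ j) (l ↑ˡ n) * walks M k (l ↑ˡ n))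
      + ∑[ l < n ] (M (m ↑ʳ j) (m ↑ʳ l) * walks M k (m ↑ʳ l))
      ≡⟨ cong₂ _+_ (sum-cong-≗ (λ l → trans (cong₂ _*_ (bottom-left j l) (walks-↑ˡ k l))
                                            (*-identityˡ (walks A k l))))
                   (sum-cong-≗ (λ l → cong₂ _*_ (bottom-right j l) (walks-↑ʳ k l))) ⟩
    σ k + ∑[ l < n ] (B j l * (walks B k l + c k l))
      ≡⟨ cong (σ k +_) (trans (sum-cong-≗ (λ l → *-distribˡ-+ (B j l) (walks B k l) (c k l)))
                           (∑-distrib-+ (λ l → B j l * walks B k l) (λ l → B j l * c k l))) ⟩
    σ k + (walks B (suc k) j + ∑[ l < n ] (B j l * c k l))
      ≡⟨ trans (+-comm (σ k) _) (+-assoc (walks B (suc k) j) (∑[ l < n ] (B j l * c k l)) (σ k)) ⟩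
    walks B (suc k) j + (∑[ l < n ] (B j l * c k l) + σ k)
      ≡⟨ cong (walks B (suc k) j +_) (sym (convolution-suc σ B k j)) ⟩
    walks B (suc k) j + c (suc k) j
      ∎
    where
    c : ℕ → Fin n → ℕ
    c = convolution σ B

  total-^^-⊕ : ∀ k → total (M ^^ k) ≡ total (A ^^ k) + total (B ^^ k)
                      + ∑[ i < k ] (total (A ^^ toℕ i) * total (B ^^ (k ∸ suc (toℕ i))))
  total-^^-⊕ k = begin
    total (M ^^ k)
      ≡⟨ total-^^ M k ⟩
    sum (walks M k)
      ≡⟨ sum-↑ m (walks M k) ⟩
    ∑[ i < m ] walks M k (i ↑ˡ n) + ∑[ j < n ] walks M k (m ↑ʳ j)
      ≡⟨ cong₂ _+_ (sum-cong-≗ (walks-↑ˡ k))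
                   (trans (sum-cong-≗ (walks-↑ʳ k)) (∑-distrib-+ (walks B k) (convolution σ B k))) ⟩
    sum (walks A k) + (sum (walks B k) + sum (convolution σ B k))
      ≡⟨ sym (+-assoc (sum (walks A k)) (sum (walks B k)) (sum (convolution σ B k))) ⟩
    sum (walks A k) + sum (walks B k) + sum (convolution σ B k)
      ≡⟨ cong₂ _+_ (cong₂ _+_ (sym (total-^^ A k)) (sym (total-^^ B k)))
                   (trans (sum-convolution σ B k)
                          (sum-cong-≗ {k} (λ i → sym (cong₂ _*_ (total-^^ A (toℕ i))
                                                                (total-^^ B (k ∸ suc (toℕ i))))))) ⟩
    total (A ^^ k) + total (B ^^ k)
      + ∑[ i < k ] (total (A ^^ toℕ i) * total (B ^^ (k ∸ suc (toℕ i))))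
      ∎

lemma6p1 : {m n : ℕ} (Γ₁ : Tournament m) (Γ₂ : Tournament n)
    → (k : ℕ) → 1 ≤ k
    → total (adj⊕ Γ₁ Γ₂ ^^ k)
      ≡ total (adj Γ₁ ^^ k) + total (adj Γ₂ ^^ k)
        + ∑ k (λ i → total (adj Γ₁ ^^ toℕ i) * total (adj Γ₂ ^^ (k ∸ suc (toℕ i))))
lemma6p1 Γ₁ Γ₂ k _ =
  trans (total-^^-⊕ (adj⊕-is⊕ Γ₁ Γ₂) k)
        (cong (total (adj Γ₁ ^^ k) + total (adj Γ₂ ^^ k) +_) (sym (∑≡sum k _)))
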